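{- Let $v\equiv 13\pmod{20}$. Then there is no decomposition of the edge set of $K_v$ into $2$ copies of $K_3$, $7$ copies of $K_4$ and $\frac{v^2-v-96}{20}$ copies of $K_5$.
   Context: A decomposition of the edge set of $K_v$ into cliques means a collection of complete subgraphs of $K_v$ such that every edge of $K_v$ lies in exactly one of them. -}

module Defs where

open import Data.Nat using (ℕ; _≡ᵇ_)
open import Data.Fin using (Fin; _≟_)
open import Data.List using (List; length; filter)
open import Data.List.Relation.Unary.Unique.Propositional using (Unique)
open import Data.List.Relation.Unary.All using (All)
open import Data.List.Membership.Propositional using (_∈_)
open import Data.List.Membership.DecPropositional using () renaming (_∈?_ to ∈?-gen)
open import Data.Product using (_×_)
open import Relation.Binary.PropositionalEquality using (_≡_)
open import Relation.Nullary using (¬_)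
open import Relation.Nullary.Decidable using (_×-dec_)

-- A complete subgraph of K_v (vertex set Fin v) is given by its vertex list,
-- with pairwise distinct vertices. Its order is the list length.
Clique : ℕ → Set
Clique v = List (Fin v)

countContaining : ∀ {v} → Fin v → Fin v → List (Clique v) → ℕ
countContaining {v} x y bs =
  length (filter (λ b → ∈?-gen _≟_ x b ×-dec ∈?-gen _≟_ y b) bs)

countOrder : ∀ {v} → ℕ → List (Clique v) → ℕ
countOrder k bs = length (filter (λ b → Data.Nat._≟_ (length b) k) bs)

IsCliqueDecomposition : (v : ℕ) → List (Clique v) → Set
IsCliqueDecomposition v bs =
  All Unique bs × (∀ (x y : Fin v) → ¬ (x ≡ y) → countContaining x y bs ≡ 1)

-- Write r_k(x) for the number of blocks of order k through the point x. The three block counts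
-- add up to the number of blocks, so every block has order 3, 4 or 5, and counting the edges at x
-- gives 2 r₃(x) + 3 r₄(x) + 4 r₅(x) = v − 1 ≡ 0 (mod 4). Hence r₄(x) is even, and r₄(x) = 2 forces
-- r₃(x) to be odd, so 4 r₄(x) ≤ r₄(x)² + 4 r₃(x) in every case. Summing over x, with Σ r₄ = 4·7,
-- Σ r₃ = 3·2 and Σ r₄² ≤ 7² + 3·7 (distinct blocks share at most one point), gives 112 ≤ 94.
module Submission where

open import Defs
open import Data.Bool using (if_then_else_)
open import Data.Fin as Fin using (Fin; zero; suc; punchIn; punchOut)
open import Data.Fin.Properties as Finₚ using (suc-injective; punchInᵢ≢i; punchIn-punchOut)
open import Data.List using (List; []; _∷_; length; filter; lookup)
open import Data.List.Membership.Propositional using (_∈_)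
open import Data.List.Membership.Propositional.Properties using (∈-lookup)
open import Data.List.Membership.DecPropositional using () renaming (_∈?_ to ∈?-gen)
open import Data.List.Relation.Unary.All as All using (All)
open import Data.List.Relation.Unary.AllPairs using ([]; _∷_)
open import Data.List.Relation.Unary.Unique.Propositional using (Unique)
open import Data.Nat as ℕ using (ℕ; zero; suc; _+_; _*_; _∸_; _%_; _/_; _≤_; z≤n; s≤s)
open import Data.Nat.DivMod using (m≡m%n+[m/n]*n)
open import Data.Nat.Properties hiding (suc-injective)
open import Data.Nat.Tactic.RingSolver using (solve-∀)
open import Data.Product using (_×_; _,_; proj₁; proj₂)
open import Function using (_∘_)
open import Relation.Binary.PropositionalEquality
open import Relation.Nullary using (¬_; Dec; does; yes; no; contradiction)
open import Relation.Nullary.Decidable using (_×-dec_; from-no)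
open import Relation.Unary using (Pred; Decidable)
open import Algebra.Properties.CommutativeSemigroup *-commutativeSemigroup
  using () renaming (interchange to *-interchange)
open import Algebra.Properties.Semiring.Sum +-*-semiring
  using (sum; sum-syntax; sum-cong-≗; sum-remove; sum-replicate-zero; ∑-distrib-+; ∑-comm;
         *-distribˡ-sum; *-distribʳ-sum)

𝟙 : ∀ {p} {P : Set p} → Dec P → ℕ
𝟙 d = if does d then 1 else 0

𝟙-yes : ∀ {p} {P : Set p} (d : Dec P) → P → 𝟙 d ≡ 1
𝟙-yes (yes _) _ = refl
𝟙-yes (no ¬p) p = contradiction p ¬p

𝟙-no : ∀ {p} {P : Set p} (d : Dec P) → ¬ P → 𝟙 d ≡ 0
𝟙-no (yes p) ¬p = contradiction p ¬p
𝟙-no (no _) _ = refl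

𝟙-idem : ∀ {p} {P : Set p} (d : Dec P) → 𝟙 d * 𝟙 d ≡ 𝟙 d
𝟙-idem (yes _) = refl
𝟙-idem (no _) = refl

𝟙-×-dec : ∀ {p q} {P : Set p} {Q : Set q} (d : Dec P) (e : Dec Q) → 𝟙 (d ×-dec e) ≡ 𝟙 d * 𝟙 e
𝟙-×-dec (yes _) (yes _) = refl
𝟙-×-dec (yes _) (no _) = refl
𝟙-×-dec (no _) _ = refl

𝟙-≡-* : ∀ {n k : ℕ} (d : Dec (n ≡ k)) → 𝟙 d * n ≡ k * 𝟙 d
𝟙-≡-* {n} (yes refl) = *-comm 1 n
𝟙-≡-* {k = k} (no _) = sym (*-zeroʳ k)

length-filter≡∑𝟙 : ∀ {a p} {A : Set a} {P : Pred A p} (P? : Decidable P) (xs : List A) →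
  length (filter P? xs) ≡ ∑[ i < length xs ] 𝟙 (P? (lookup xs i))
length-filter≡∑𝟙 P? [] = refl
length-filter≡∑𝟙 P? (x ∷ xs) with P? x
... | yes _ = cong suc (length-filter≡∑𝟙 P? xs)
... | no _ = length-filter≡∑𝟙 P? xs

∑-const : ∀ n c → ∑[ i < n ] c ≡ n * c
∑-const zero c = refl
∑-const (suc n) c = cong (c +_) (∑-const n c)

∑-mono-≤ : ∀ {n} {f g : Fin n → ℕ} → (∀ i → f i ≤ g i) → sum f ≤ sum g
∑-mono-≤ {zero} f≤g = z≤n
∑-mono-≤ {suc n} f≤g = +-mono-≤ (f≤g zero) (∑-mono-≤ (f≤g ∘ suc))

≤∧∑≡⇒≗ : ∀ {n} {f g : Fin n → ℕ} → (∀ i → f i ≤ g i) → sum f ≡ sum g → ∀ i → f i ≡ g i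
≤∧∑≡⇒≗ {suc n} {f} {g} f≤g ∑f≡∑g = λ
  { zero → f₀≡g₀
  ; (suc i) → ≤∧∑≡⇒≗ (f≤g ∘ suc) (+-cancelˡ-≡ (f zero) _ _ (trans ∑f≡∑g (cong (_+ _) (sym f₀≡g₀)))) i }
  where
  f₀≡g₀ : f zero ≡ g zero
  f₀≡g₀ = ≤-antisym (f≤g zero) (+-cancelʳ-≤ _ _ _
    (≤-trans (≤-reflexive (sym ∑f≡∑g)) (+-monoʳ-≤ (f zero) (∑-mono-≤ (f≤g ∘ suc)))))

f≤∑f : ∀ {n} (f : Fin n → ℕ) i → f i ≤ sum f
f≤∑f f zero = m≤m+n (f zero) _
f≤∑f f (suc i) = ≤-trans (f≤∑f (f ∘ suc) i) (m≤n+m _ (f zero))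

f+f≤∑f : ∀ {n} (f : Fin n → ℕ) {i j} → i ≢ j → f i + f j ≤ sum f
f+f≤∑f {suc n} f {i} {j} i≢j = begin
  f i + f j                         ≡⟨ cong (λ k → f i + f k) (punchIn-punchOut i≢j) ⟨
  f i + f (punchIn i (punchOut i≢j)) ≤⟨ +-monoʳ-≤ (f i) (f≤∑f (f ∘ punchIn i) (punchOut i≢j)) ⟩
  f i + sum (f ∘ punchIn i)          ≡⟨ sum-remove f ⟨
  sum f                              ∎
  where open ≤-Reasoning

∑-ones-except : ∀ {n} (f : Fin n → ℕ) x → (∀ y → y ≢ x → f y ≡ 1) → sum f + 1 ≡ n + f x
∑-ones-except {suc n} f x f≡1 = begin
  sum f + 1                     ≡⟨ cong (_+ 1) (sum-remove f) ⟩
  f x + sum (f ∘ punchIn x) + 1 ≡⟨ cong (λ s → f x + s + 1) (sum-cong-≗ (λ y → f≡1 (punchIn x y) (punchInᵢ≢i x y))) ⟩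
  f x + ∑[ y < n ] 1 + 1        ≡⟨ cong (λ s → f x + s + 1) (trans (∑-const n 1) (*-identityʳ n)) ⟩
  f x + n + 1                   ≡⟨ rearrange (f x) n ⟩
  suc n + f x                   ∎
  where
  open ≡-Reasoning
  rearrange : ∀ a n → a + n + 1 ≡ suc n + a
  rearrange = solve-∀

∑-𝟙-≟ : ∀ {n} (i : Fin n) → ∑[ j < n ] 𝟙 (j Fin.≟ i) ≡ 1
∑-𝟙-≟ {suc n} zero = cong suc (sum-replicate-zero n)
∑-𝟙-≟ {suc n} (suc i) = ∑-𝟙-≟ i

∑-𝟙-≤1 : ∀ {n p} {P : Pred (Fin n) p} (P? : Decidable P) → (∀ {x y} → P x → P y → x ≡ y) →
  ∑[ x < n ] 𝟙 (P? x) ≤ 1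
∑-𝟙-≤1 {zero} P? unique = z≤n
∑-𝟙-≤1 {suc n} P? unique with P? zero
... | yes p = ≤-reflexive (cong suc (trans (sum-cong-≗ rest≡0) (sum-replicate-zero n)))
  where
  rest≡0 : ∀ x → 𝟙 (P? (suc x)) ≡ 0
  rest≡0 x = 𝟙-no (P? (suc x)) (λ q → Finₚ.0≢1+n (unique p q))
... | no _ = ∑-𝟙-≤1 (P? ∘ suc) (λ p q → suc-injective (unique p q))

_∈?_ : ∀ {v} (x : Fin v) (b : Clique v) → Dec (x ∈ b)
x ∈? b = ∈?-gen Fin._≟_ x b

𝟙-∈-∷ : ∀ {v} (x z : Fin v) {b : Clique v} → All (z ≢_) b → 𝟙 (x ∈? (z ∷ b)) ≡ 𝟙 (x Fin.≟ z) + 𝟙 (x ∈? b)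
𝟙-∈-∷ x z {b} z∉b with x Fin.≟ z
... | yes refl = cong suc (sym (𝟙-no (x ∈? b) (λ x∈b → All.lookup z∉b x∈b refl)))
... | no _ = refl

∑-𝟙-∈ : ∀ {v} (b : Clique v) → Unique b → ∑[ x < v ] 𝟙 (x ∈? b) ≡ length b
∑-𝟙-∈ {v} [] [] = sum-replicate-zero v
∑-𝟙-∈ {v} (z ∷ b) (z∉b ∷ u) = begin
  ∑[ x < v ] 𝟙 (x ∈? (z ∷ b))                       ≡⟨ sum-cong-≗ (λ x → 𝟙-∈-∷ x z z∉b) ⟩
  ∑[ x < v ] (𝟙 (x Fin.≟ z) + 𝟙 (x ∈? b))           ≡⟨ ∑-distrib-+ (λ x → 𝟙 (x Fin.≟ z)) (λ x → 𝟙 (x ∈? b)) ⟩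
  ∑[ x < v ] 𝟙 (x Fin.≟ z) + ∑[ x < v ] 𝟙 (x ∈? b)  ≡⟨ cong₂ _+_ (∑-𝟙-≟ z) (∑-𝟙-∈ b u) ⟩
  suc (length b)                                     ∎
  where open ≡-Reasoning

∑∑-diagonal : ∀ {m} (e : Fin m → ℕ) k →
  ∑[ i < m ] ∑[ j < m ] (e i * e j + k * (e i * 𝟙 (j Fin.≟ i))) ≡ sum e * sum e + k * sum e
∑∑-diagonal {m} e k = begin
  ∑[ i < m ] ∑[ j < m ] (e i * e j + k * (e i * 𝟙 (j Fin.≟ i)))
    ≡⟨ sum-cong-≗ (λ i → ∑-distrib-+ (λ j → e i * e j) (λ j → k * (e i * 𝟙 (j Fin.≟ i)))) ⟩
  ∑[ i < m ] (∑[ j < m ] (e i * e j) + ∑[ j < m ] (k * (e i * 𝟙 (j Fin.≟ i))))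
    ≡⟨ sum-cong-≗ (λ i → cong₂ _+_ (sym (*-distribˡ-sum (e i) e)) (diagonal i)) ⟩
  ∑[ i < m ] (e i * sum e + k * e i)
    ≡⟨ ∑-distrib-+ (λ i → e i * sum e) (λ i → k * e i) ⟩
  ∑[ i < m ] (e i * sum e) + ∑[ i < m ] (k * e i)
    ≡⟨ cong₂ _+_ (*-distribʳ-sum (sum e) e) (*-distribˡ-sum k e) ⟨
  sum e * sum e + k * sum e
    ∎
  where
  open ≡-Reasoning
  diagonal : ∀ i → ∑[ j < m ] (k * (e i * 𝟙 (j Fin.≟ i))) ≡ k * e i
  diagonal i = begin
    ∑[ j < m ] (k * (e i * 𝟙 (j Fin.≟ i)))  ≡⟨ *-distribˡ-sum k (λ j → e i * 𝟙 (j Fin.≟ i)) ⟨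
    k * ∑[ j < m ] (e i * 𝟙 (j Fin.≟ i))    ≡⟨ cong (k *_) (*-distribˡ-sum (e i) (λ j → 𝟙 (j Fin.≟ i))) ⟨
    k * (e i * ∑[ j < m ] 𝟙 (j Fin.≟ i))    ≡⟨ cong (λ s → k * (e i * s)) (∑-𝟙-≟ i) ⟩
    k * (e i * 1)                            ≡⟨ cong (k *_) (*-identityʳ (e i)) ⟩
    k * e i                                  ∎

*-order345 : ∀ n c → 𝟙 (n ℕ.≟ 3) + 𝟙 (n ℕ.≟ 4) + 𝟙 (n ℕ.≟ 5) ≡ 1 →
  c * n ≡ c + (2 * (𝟙 (n ℕ.≟ 3) * c) + 3 * (𝟙 (n ℕ.≟ 4) * c) + 4 * (𝟙 (n ℕ.≟ 5) * c))
*-order345 3 c _ = lemma c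
  where
  lemma : ∀ c → c * 3 ≡ c + (2 * (1 * c) + 3 * (0 * c) + 4 * (0 * c))
  lemma = solve-∀
*-order345 4 c _ = lemma c
  where
  lemma : ∀ c → c * 4 ≡ c + (2 * (0 * c) + 3 * (1 * c) + 4 * (0 * c))
  lemma = solve-∀
*-order345 5 c _ = lemma c
  where
  lemma : ∀ c → c * 5 ≡ c + (2 * (0 * c) + 3 * (0 * c) + 4 * (1 * c))
  lemma = solve-∀
*-order345 0 c ()
*-order345 1 c ()
*-order345 2 c ()
*-order345 (suc (suc (suc (suc (suc (suc n)))))) c ()

4t≢1+2k : ∀ t k → 4 * t ≢ suc (2 * k)
4t≢1+2k t k eq = even≢odd (2 * t) k (trans (four t) eq)
  where
  four : ∀ t → 2 * (2 * t) ≡ 4 * t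
  four = solve-∀

2a+3b+4c≡4t⇒4b≤b²+4a : ∀ a b c t → 2 * a + 3 * b + 4 * c ≡ 4 * t → 4 * b ≤ b * b + 4 * a
2a+3b+4c≡4t⇒4b≤b²+4a a 0 c t _ = z≤n
2a+3b+4c≡4t⇒4b≤b²+4a a 1 c t eq = contradiction (trans (sym eq) (odd a c)) (4t≢1+2k t (a + 1 + 2 * c))
  where
  odd : ∀ a c → 2 * a + 3 * 1 + 4 * c ≡ suc (2 * (a + 1 + 2 * c))
  odd = solve-∀
2a+3b+4c≡4t⇒4b≤b²+4a 0 2 c t eq =
  contradiction (*-cancelˡ-≡ _ _ 2 (trans (twice t) (trans (sym eq) (odd c)))) (even≢odd t (1 + c))
  where
  twice : ∀ t → 2 * (2 * t) ≡ 4 * t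
  twice = solve-∀
  odd : ∀ c → 2 * 0 + 3 * 2 + 4 * c ≡ 2 * suc (2 * (1 + c))
  odd = solve-∀
2a+3b+4c≡4t⇒4b≤b²+4a (suc a) 2 c t _ = +-monoʳ-≤ 4 (*-monoʳ-≤ 4 (s≤s z≤n))
2a+3b+4c≡4t⇒4b≤b²+4a a 3 c t eq = contradiction (trans (sym eq) (odd a c)) (4t≢1+2k t (a + 4 + 2 * c))
  where
  odd : ∀ a c → 2 * a + 3 * 3 + 4 * c ≡ suc (2 * (a + 4 + 2 * c))
  odd = solve-∀
2a+3b+4c≡4t⇒4b≤b²+4a a b@(suc (suc (suc (suc _)))) c t _ =
  ≤-trans (*-monoˡ-≤ b {4} {b} (s≤s (s≤s (s≤s (s≤s z≤n))))) (m≤m+n (b * b) (4 * a))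

module Incidence {v : ℕ} (bs : List (Clique v)) where

  m : ℕ
  m = length bs

  B : Fin m → Clique v
  B = lookup bs

  χ : Fin v → Fin m → ℕ
  χ x i = 𝟙 (x ∈? B i)

  ε : ℕ → Fin m → ℕ
  ε k i = 𝟙 (length (B i) ℕ.≟ k)

  r : ℕ → Fin v → ℕ
  r k x = ∑[ i < m ] (ε k i * χ x i)

  countContaining≡∑ : ∀ x y → countContaining x y bs ≡ ∑[ i < m ] (χ x i * χ y i)
  countContaining≡∑ x y =
    trans (length-filter≡∑𝟙 _ bs) (sum-cong-≗ (λ i → 𝟙-×-dec (x ∈? B i) (y ∈? B i)))

  countOrder≡∑ : ∀ k → countOrder k bs ≡ ∑[ i < m ] ε k i
  countOrder≡∑ k = length-filter≡∑𝟙 _ bs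

  ordersIn345 : countOrder 3 bs + countOrder 4 bs + countOrder 5 bs ≡ m → ∀ i → ε 3 i + ε 4 i + ε 5 i ≡ 1
  ordersIn345 total = ≤∧∑≡⇒≗ (λ i → atMostOneOf345 (length (B i))) (begin
    ∑[ i < m ] (ε 3 i + ε 4 i + ε 5 i)                 ≡⟨ ∑-distrib-+ (λ i → ε 3 i + ε 4 i) (ε 5) ⟩
    ∑[ i < m ] (ε 3 i + ε 4 i) + ∑[ i < m ] ε 5 i      ≡⟨ cong (_+ sum (ε 5)) (∑-distrib-+ (ε 3) (ε 4)) ⟩
    sum (ε 3) + sum (ε 4) + sum (ε 5)                  ≡⟨ cong₂ _+_ (cong₂ _+_ (countOrder≡∑ 3) (countOrder≡∑ 4)) (countOrder≡∑ 5) ⟨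
    countOrder 3 bs + countOrder 4 bs + countOrder 5 bs ≡⟨ total ⟩
    m                                                  ≡⟨ trans (∑-const m 1) (*-identityʳ m) ⟨
    ∑[ i < m ] 1                                       ∎)
    where
    open ≡-Reasoning
    atMostOneOf345 : ∀ n → 𝟙 (n ℕ.≟ 3) + 𝟙 (n ℕ.≟ 4) + 𝟙 (n ℕ.≟ 5) ≤ 1
    atMostOneOf345 0 = z≤n
    atMostOneOf345 1 = z≤n
    atMostOneOf345 2 = z≤n
    atMostOneOf345 3 = s≤s z≤n
    atMostOneOf345 4 = s≤s z≤n
    atMostOneOf345 5 = s≤s z≤n
    atMostOneOf345 (suc (suc (suc (suc (suc (suc n)))))) = z≤n

module Decomposition {v : ℕ} {bs : List (Clique v)} (decomposition : IsCliqueDecomposition v bs) where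

  open Incidence bs

  private
    unique : ∀ i → Unique (B i)
    unique i = All.lookup (proj₁ decomposition) (∈-lookup i)

    cover : ∀ {x y} → x ≢ y → ∑[ i < m ] (χ x i * χ y i) ≡ 1
    cover {x} {y} x≢y = trans (sym (countContaining≡∑ x y)) (proj₂ decomposition x y x≢y)

  ∑χ≡length : ∀ i → ∑[ x < v ] χ x i ≡ length (B i)
  ∑χ≡length i = ∑-𝟙-∈ (B i) (unique i)

  ∑r≡k*countOrder : ∀ k → ∑[ x < v ] r k x ≡ k * countOrder k bs
  ∑r≡k*countOrder k = begin
    ∑[ x < v ] ∑[ i < m ] (ε k i * χ x i)  ≡⟨ ∑-comm (λ x i → ε k i * χ x i) ⟩
    ∑[ i < m ] ∑[ x < v ] (ε k i * χ x i)  ≡⟨ sum-cong-≗ (λ i → sym (*-distribˡ-sum (ε k i) (λ x → χ x i))) ⟩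
    ∑[ i < m ] (ε k i * ∑[ x < v ] χ x i)  ≡⟨ sum-cong-≗ (λ i → cong (ε k i *_) (∑χ≡length i)) ⟩
    ∑[ i < m ] (ε k i * length (B i))      ≡⟨ sum-cong-≗ (λ i → 𝟙-≡-* (length (B i) ℕ.≟ k)) ⟩
    ∑[ i < m ] (k * ε k i)                 ≡⟨ *-distribˡ-sum k (ε k) ⟨
    k * ∑[ i < m ] ε k i                   ≡⟨ cong (k *_) (countOrder≡∑ k) ⟨
    k * countOrder k bs                    ∎
    where open ≡-Reasoning

  degree : ∀ x → ∑[ i < m ] (χ x i * length (B i)) + 1 ≡ v + ∑[ i < m ] χ x i
  degree x = begin
    ∑[ i < m ] (χ x i * length (B i)) + 1            ≡⟨ cong (_+ 1) (sum-cong-≗ (λ i → cong (χ x i *_) (∑χ≡length i))) ⟨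
    ∑[ i < m ] (χ x i * ∑[ y < v ] χ y i) + 1        ≡⟨ cong (_+ 1) (sum-cong-≗ (λ i → *-distribˡ-sum (χ x i) (λ y → χ y i))) ⟩
    ∑[ i < m ] ∑[ y < v ] (χ x i * χ y i) + 1        ≡⟨ cong (_+ 1) (∑-comm (λ i y → χ x i * χ y i)) ⟩
    ∑[ y < v ] ∑[ i < m ] (χ x i * χ y i) + 1        ≡⟨ ∑-ones-except _ x (λ y y≢x → cover (y≢x ∘ sym)) ⟩
    v + ∑[ i < m ] (χ x i * χ x i)                   ≡⟨ cong (v +_) (sum-cong-≗ (λ i → 𝟙-idem (x ∈? B i))) ⟩
    v + ∑[ i < m ] χ x i                             ∎
    where open ≡-Reasoning

  overlap≤1 : ∀ {i j} → i ≢ j → ∑[ x < v ] (χ x i * χ x j) ≤ 1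
  overlap≤1 {i} {j} i≢j = begin
    ∑[ x < v ] (χ x i * χ x j)                  ≡⟨ sum-cong-≗ (λ x → 𝟙-×-dec (x ∈? B i) (x ∈? B j)) ⟨
    ∑[ x < v ] 𝟙 (x ∈? B i ×-dec x ∈? B j)     ≤⟨ ∑-𝟙-≤1 (λ x → x ∈? B i ×-dec x ∈? B j) atMostOne ⟩
    1                                           ∎
    where
    open ≤-Reasoning
    atMostOne : ∀ {x y} → x ∈ B i × x ∈ B j → y ∈ B i × y ∈ B j → x ≡ y
    atMostOne {x} {y} (x∈i , x∈j) (y∈i , y∈j) with x Fin.≟ y
    ... | yes x≡y = x≡y
    ... | no x≢y = contradiction (begin
      2                                                    ≡⟨ cong₂ _+_ (both i x∈i y∈i) (both j x∈j y∈j) ⟨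
      χ x i * χ y i + χ x j * χ y j                        ≤⟨ f+f≤∑f (λ k → χ x k * χ y k) i≢j ⟩
      ∑[ k < m ] (χ x k * χ y k)                           ≡⟨ cover x≢y ⟩
      1                                                    ∎) 1+n≰n
      where
      both : ∀ k → x ∈ B k → y ∈ B k → χ x k * χ y k ≡ 1
      both k x∈k y∈k = cong₂ _*_ (𝟙-yes (x ∈? B k) x∈k) (𝟙-yes (y ∈? B k) y∈k)

  module _ (k : ℕ) where

    private
      e : Fin m → ℕ
      e = ε (suc k)

      a : Fin m → Fin v → ℕ
      a i x = e i * χ x i

    ∑-blockPair≤ : ∀ i j → ∑[ x < v ] (a i x * a j x) ≤ e i * e j + k * (e i * 𝟙 (j Fin.≟ i))
    ∑-blockPair≤ i j with j Fin.≟ i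
    ... | yes refl = ≤-reflexive (begin
      ∑[ x < v ] (a i x * a i x)        ≡⟨ sum-cong-≗ a-idem ⟩
      ∑[ x < v ] (e i * χ x i)          ≡⟨ *-distribˡ-sum (e i) (λ x → χ x i) ⟨
      e i * ∑[ x < v ] χ x i            ≡⟨ cong (e i *_) (∑χ≡length i) ⟩
      e i * length (B i)                ≡⟨ 𝟙-≡-* (length (B i) ℕ.≟ suc k) ⟩
      e i + k * e i                     ≡⟨ cong₂ (λ p q → p + k * q) (𝟙-idem (length (B i) ℕ.≟ suc k)) (*-identityʳ (e i)) ⟨
      e i * e i + k * (e i * 1)         ∎)
      where
      open ≡-Reasoning
      a-idem : ∀ x → a i x * a i x ≡ a i x
      a-idem x = trans (*-interchange (e i) (χ x i) (e i) (χ x i))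
                       (cong₂ _*_ (𝟙-idem (length (B i) ℕ.≟ suc k)) (𝟙-idem (x ∈? B i)))
    ... | no j≢i = begin
      ∑[ x < v ] (a i x * a j x)                 ≡⟨ sum-cong-≗ (λ x → *-interchange (e i) (χ x i) (e j) (χ x j)) ⟩
      ∑[ x < v ] (e i * e j * (χ x i * χ x j))   ≡⟨ *-distribˡ-sum (e i * e j) (λ x → χ x i * χ x j) ⟨
      e i * e j * ∑[ x < v ] (χ x i * χ x j)     ≤⟨ *-monoʳ-≤ (e i * e j) (overlap≤1 (j≢i ∘ sym)) ⟩
      e i * e j * 1                              ≡⟨ *-identityʳ (e i * e j) ⟩
      e i * e j                                  ≤⟨ m≤m+n (e i * e j) _ ⟩
      e i * e j + k * (e i * 0)                  ∎
      where open ≤-Reasoning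

    ∑r²≤c²+kc : ∑[ x < v ] (r (suc k) x * r (suc k) x) ≤ countOrder (suc k) bs * countOrder (suc k) bs + k * countOrder (suc k) bs
    ∑r²≤c²+kc = begin
      ∑[ x < v ] (r (suc k) x * r (suc k) x)                  ≡⟨ sum-cong-≗ (λ x → square-∑ (λ i → a i x)) ⟩
      ∑[ x < v ] ∑[ i < m ] ∑[ j < m ] (a i x * a j x)        ≡⟨ ∑-comm (λ x i → ∑[ j < m ] (a i x * a j x)) ⟩
      ∑[ i < m ] ∑[ x < v ] ∑[ j < m ] (a i x * a j x)        ≡⟨ sum-cong-≗ (λ i → ∑-comm (λ x j → a i x * a j x)) ⟩
      ∑[ i < m ] ∑[ j < m ] ∑[ x < v ] (a i x * a j x)        ≤⟨ ∑-mono-≤ (λ i → ∑-mono-≤ (∑-blockPair≤ i)) ⟩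
      ∑[ i < m ] ∑[ j < m ] (e i * e j + k * (e i * 𝟙 (j Fin.≟ i)))  ≡⟨ ∑∑-diagonal e k ⟩
      sum e * sum e + k * sum e                                ≡⟨ cong (λ c → c * c + k * c) (countOrder≡∑ (suc k)) ⟨
      c * c + k * c                                            ∎
      where
      open ≤-Reasoning
      c : ℕ
      c = countOrder (suc k) bs
      square-∑ : ∀ (f : Fin m → ℕ) → sum f * sum f ≡ ∑[ i < m ] ∑[ j < m ] (f i * f j)
      square-∑ f = trans (*-distribʳ-sum (sum f) f) (sum-cong-≗ (λ i → *-distribˡ-sum (f i) f))

  module _ (orders : ∀ i → ε 3 i + ε 4 i + ε 5 i ≡ 1) where

    degreeEquation : ∀ x → 2 * r 3 x + 3 * r 4 x + 4 * r 5 x + 1 ≡ v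
    degreeEquation x = +-cancelˡ-≡ (sum (χ x)) _ _ (begin
      sum (χ x) + (2 * r 3 x + 3 * r 4 x + 4 * r 5 x + 1)  ≡⟨ +-assoc (sum (χ x)) _ 1 ⟨
      sum (χ x) + (2 * r 3 x + 3 * r 4 x + 4 * r 5 x) + 1  ≡⟨ cong (_+ 1) expand ⟩
      ∑[ i < m ] (χ x i * length (B i)) + 1                ≡⟨ degree x ⟩
      v + sum (χ x)                                        ≡⟨ +-comm v _ ⟩
      sum (χ x) + v                                        ∎)
      where
      open ≡-Reasoning
      f : ℕ → Fin m → ℕ
      f k i = ε k i * χ x i
      weighted : ∑[ i < m ] (2 * f 3 i + 3 * f 4 i + 4 * f 5 i) ≡ 2 * r 3 x + 3 * r 4 x + 4 * r 5 x
      weighted = begin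
        ∑[ i < m ] (2 * f 3 i + 3 * f 4 i + 4 * f 5 i)                 ≡⟨ ∑-distrib-+ (λ i → 2 * f 3 i + 3 * f 4 i) (λ i → 4 * f 5 i) ⟩
        ∑[ i < m ] (2 * f 3 i + 3 * f 4 i) + ∑[ i < m ] (4 * f 5 i)     ≡⟨ cong (_+ ∑[ i < m ] (4 * f 5 i)) (∑-distrib-+ (λ i → 2 * f 3 i) (λ i → 3 * f 4 i)) ⟩
        ∑[ i < m ] (2 * f 3 i) + ∑[ i < m ] (3 * f 4 i) + ∑[ i < m ] (4 * f 5 i)
          ≡⟨ cong₂ _+_ (cong₂ _+_ (*-distribˡ-sum 2 (f 3)) (*-distribˡ-sum 3 (f 4))) (*-distribˡ-sum 4 (f 5)) ⟨
        2 * r 3 x + 3 * r 4 x + 4 * r 5 x                               ∎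
      expand : sum (χ x) + (2 * r 3 x + 3 * r 4 x + 4 * r 5 x) ≡ ∑[ i < m ] (χ x i * length (B i))
      expand = begin
        sum (χ x) + (2 * r 3 x + 3 * r 4 x + 4 * r 5 x)                        ≡⟨ cong (sum (χ x) +_) weighted ⟨
        sum (χ x) + ∑[ i < m ] (2 * f 3 i + 3 * f 4 i + 4 * f 5 i)             ≡⟨ ∑-distrib-+ (χ x) (λ i → 2 * f 3 i + 3 * f 4 i + 4 * f 5 i) ⟨
        ∑[ i < m ] (χ x i + (2 * f 3 i + 3 * f 4 i + 4 * f 5 i))               ≡⟨ sum-cong-≗ (λ i → *-order345 (length (B i)) (χ x i) (orders i)) ⟨
        ∑[ i < m ] (χ x i * length (B i))                                      ∎

    16c₄≤c₄²+3c₄+12c₃ : ∀ t → v ≡ 4 * t + 1 →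
      16 * countOrder 4 bs ≤ countOrder 4 bs * countOrder 4 bs + 3 * countOrder 4 bs + 12 * countOrder 3 bs
    16c₄≤c₄²+3c₄+12c₃ t v≡4t+1 = begin
      16 * countOrder 4 bs                    ≡⟨ *-assoc 4 4 (countOrder 4 bs) ⟩
      4 * (4 * countOrder 4 bs)               ≡⟨ cong (4 *_) (∑r≡k*countOrder 4) ⟨
      4 * ∑[ x < v ] r 4 x                    ≡⟨ *-distribˡ-sum 4 (r 4) ⟩
      ∑[ x < v ] (4 * r 4 x)                  ≤⟨ ∑-mono-≤ pointwise ⟩
      ∑[ x < v ] (r 4 x * r 4 x + 4 * r 3 x)  ≡⟨ ∑-distrib-+ (λ x → r 4 x * r 4 x) (λ x → 4 * r 3 x) ⟩
      ∑[ x < v ] (r 4 x * r 4 x) + ∑[ x < v ] (4 * r 3 x)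
                                              ≡⟨ cong (∑[ x < v ] (r 4 x * r 4 x) +_) (*-distribˡ-sum 4 (r 3)) ⟨
      ∑[ x < v ] (r 4 x * r 4 x) + 4 * ∑[ x < v ] r 3 x
                                              ≤⟨ +-mono-≤ (∑r²≤c²+kc 3) (≤-reflexive (cong (4 *_) (∑r≡k*countOrder 3))) ⟩
      c₄ * c₄ + 3 * c₄ + 4 * (3 * c₃)         ≡⟨ cong (c₄ * c₄ + 3 * c₄ +_) (*-assoc 4 3 c₃) ⟨
      c₄ * c₄ + 3 * c₄ + 12 * c₃              ∎
      where
      open ≤-Reasoning
      c₃ c₄ : ℕ
      c₃ = countOrder 3 bs
      c₄ = countOrder 4 bs
      pointwise : ∀ x → 4 * r 4 x ≤ r 4 x * r 4 x + 4 * r 3 x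
      pointwise x = 2a+3b+4c≡4t⇒4b≤b²+4a (r 3 x) (r 4 x) (r 5 x) t (+-cancelʳ-≡ 1 _ _ (trans (degreeEquation x) v≡4t+1))

proposition7 : (v : ℕ) → v % 20 ≡ 13 → (bs : List (Clique v)) →
    ¬ (IsCliqueDecomposition v bs
    × countOrder 3 bs ≡ 2
    × countOrder 4 bs ≡ 7
    × countOrder 5 bs ≡ (v * v ∸ v ∸ 96) / 20
    × length bs ≡ 2 + 7 + (v * v ∸ v ∸ 96) / 20)
proposition7 v v%20≡13 bs (decomposition , c₃≡2 , c₄≡7 , c₅≡N , length≡) =
  from-no (16 * 7 ℕ.≤? 7 * 7 + 3 * 7 + 12 * 2)
    (subst₂ (λ c₃ c₄ → 16 * c₄ ≤ c₄ * c₄ + 3 * c₄ + 12 * c₃) c₃≡2 c₄≡7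
      (16c₄≤c₄²+3c₄+12c₃ orders (5 * (v / 20) + 3) v≡4t+1))
  where
  open Incidence bs using (ε; ordersIn345)
  open Decomposition decomposition using (16c₄≤c₄²+3c₄+12c₃)
  orders : ∀ i → ε 3 i + ε 4 i + ε 5 i ≡ 1
  orders = ordersIn345 (trans (cong₂ _+_ (cong₂ _+_ c₃≡2 c₄≡7) c₅≡N) (sym length≡))
  v≡4t+1 : v ≡ 4 * (5 * (v / 20) + 3) + 1
  v≡4t+1 = trans (m≡m%n+[m/n]*n v 20) (trans (cong (_+ v / 20 * 20) v%20≡13) (regroup (v / 20)))
    where
    regroup : ∀ q → 13 + q * 20 ≡ 4 * (5 * q + 3) + 1
    regroup = solve-∀
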